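{- For any integers $n\ge 2$ and $1\le k\le F_{n-1}$, $$ Z(F_n + k) = F_{n+2} + Z(k). $$
   Context: The Fibonacci numbers are defined by $F_0=0$, $F_1=1$, $F_n=F_{n-1}+F_{n-2}$ for $n\ge 2$. By Zeckendorf's theorem every positive integer $m$ can be written uniquely as $m = F_{i_1}+\dots+F_{i_k}$ with $i_1>\dots>i_k\ge 2$ and consecutive indices differing by at least $2$ (the summand $1$ is always taken as $F_2$). Define $\mathrm{fib}(m) := \sum_{t=1}^k 2^{i_t-2}$; this is a strictly increasing bijection from the positive integers onto the fibbinary numbers (positive integers whose binary representation has no two consecutive ones). Let $\mathrm{odfib}(n)$ be the $n$th odd fibbinary number in increasing order, and $Z(n) := \mathrm{fib}^{ -1}(\mathrm{odfib}(n))$ (so $Z(1)=1$, $Z(2)=4$, $Z(3)=6$, $Z(4)=9,\dots$). -}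

module Defs where

open import Data.Nat using (ℕ; zero; suc; _+_; _*_; _∸_; _^_; _≤_; _<_; _≡ᵇ_)
open import Data.Nat.DivMod using (_/_; _%_)
open import Data.Bool using (Bool; true; false; _∧_; not; T)
open import Data.List using (List; []; _∷_; map; upTo; filter; length)
open import Data.Nat.ListAction using (sum)
open import Data.Bool.ListAction using (all)
open import Data.Product using (Σ; _×_; ∃; _,_)
open import Relation.Binary.PropositionalEquality using (_≡_)
open import Relation.Nullary.Decidable using (Dec)
open import Data.Bool.Properties using (T?)

F : ℕ → ℕ
F zero = 0
F (suc zero) = 1
F (suc (suc n)) = F (suc n) + F n

data IsZeck : List ℕ → Set where
  zeck-[] : IsZeck []
  zeck-1  : ∀ {i} → 2 ≤ i → IsZeck (i ∷ [])
  zeck-∷  : ∀ {i j l} → j + 2 ≤ i → IsZeck (j ∷ l) → IsZeck (i ∷ j ∷ l)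

zval : List ℕ → ℕ
zval l = sum (map F l)

bval : List ℕ → ℕ
bval l = sum (map (λ i → 2 ^ (i ∸ 2)) l)

-- Graph of fib : ℕ⁺ → fibbinary numbers.  Since the Zeckendorf representation
-- of m is unique, IsFib m x holds iff m ≥ 1 and x = fib(m).
IsFib : ℕ → ℕ → Set
IsFib m x = 1 ≤ m × Σ (List ℕ) (λ l → IsZeck l × zval l ≡ m × bval l ≡ x)

bit : ℕ → ℕ → Bool
bit x zero = (x % 2) ≡ᵇ 1
bit x (suc j) = bit (x / 2) j

-- no two consecutive ones; it suffices to look at positions j < x, since
-- bit x j = 0 for all j ≥ x.
noAdjOnes : ℕ → Bool
noAdjOnes x = all (λ j → not (bit x j ∧ bit x (suc j))) (upTo x)

positive : ℕ → Bool
positive zero = false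
positive (suc _) = true

oddFibbinary : ℕ → Bool
oddFibbinary x = positive x ∧ bit x 0 ∧ noAdjOnes x

countOddFibbinaryBelow : ℕ → ℕ
countOddFibbinaryBelow x = length (filter (λ y → T? (oddFibbinary y)) (upTo x))

-- Graph of odfib: x is the n-th (1-indexed) odd fibbinary number
IsOdfib : ℕ → ℕ → Set
IsOdfib n x = 1 ≤ n × T (oddFibbinary x) × suc (countOddFibbinaryBelow x) ≡ n

-- Graph of Z = fib⁻¹ ∘ odfib :  IsZ n z  iff  n ≥ 1 and z = Z(n)
IsZ : ℕ → ℕ → Set
IsZ n z = Σ ℕ (λ x → IsOdfib n x × IsFib z x)

{-# OPTIONS --safe #-}
module Submission where

open import Defs
open import Data.Nat using (ℕ; zero; suc; _+_; _*_; _∸_; _^_; _≤_; _<_; _≡ᵇ_; z≤n; s≤s; _<?_)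
open import Data.Nat.Properties
open import Data.Nat.DivMod using (_/_; _%_; /-congˡ; m*n/n≡m; m<n*o⇒m/o<n; +-distrib-/-∣ˡ; %-remove-+ˡ)
open import Data.Nat.Divisibility using (m∣m*n)
open import Data.Bool using (Bool; true; false; _∧_; T; if_then_else_)
open import Data.Bool.Properties using (∧-zeroʳ; ¬-not; T-≡; T-not-≡; T?; ⇔→≡)
open import Data.List using (_∷_; [_]; _++_; upTo; filter; length)
open import Data.List.Properties using (upTo-∷ʳ; filter-++; length-++)
open import Data.List.Relation.Unary.All.Properties using (all⁺; all⁻; applyUpTo⁺₂; applyUpTo⁻)
open import Data.Product using (_,_)
open import Function using (_∘_; _⇔_; mk⇔; Equivalence)
open import Relation.Binary using (tri<; tri≈; tri>)
open import Relation.Binary.PropositionalEquality using (_≡_; _≢_; refl; sym; trans; cong; cong₂; subst; module ≡-Reasoning)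
open import Relation.Nullary using (yes; no; contradiction)

open Equivalence using (to; from)

-- If x < 2 ^ m, the binary expansion of 2 ^ (m + 1) + x is a one, a zero, and then
-- the m digits of x; so 2 ^ (m + 1) + x is odd fibbinary exactly when x is, while
-- the numbers 2 ^ (m + 1) + 2 ^ m + y with y < 2 ^ m have two adjacent ones.  Hence
-- the odd fibbinary numbers below 2 ^ m satisfy the Fibonacci recursion, there are
-- F m of them, and odfib (F (m + 1) + k) = 2 ^ (m + 1) + odfib k whenever k ≤ F m.
-- A Zeckendorf representation of fib⁻¹ of that number is obtained by putting the
-- index m + 3 in front of the one of Z k, which is admissible because the leading
-- index of Z k is at most m + 1.

2^[1+n]≡2^n+2^n : ∀ n → 2 ^ suc n ≡ 2 ^ n + 2 ^ n
2^[1+n]≡2^n+2^n n = cong (2 ^ n +_) (+-identityʳ (2 ^ n))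

n<2^n : ∀ n → n < 2 ^ n
n<2^n zero = s≤s z≤n
n<2^n (suc n) = begin-strict
  suc n           ≤⟨ n<2^n n ⟩
  2 ^ n           <⟨ m<m+n (2 ^ n) (m^n>0 2 n) ⟩
  2 ^ n + 2 ^ n   ≡⟨ 2^[1+n]≡2^n+2^n n ⟨
  2 ^ suc n       ∎
  where open ≤-Reasoning

2^-cancel-< : ∀ m n → 2 ^ m < 2 ^ n → m < n
2^-cancel-< m n 2^m<2^n = ≰⇒> (λ n≤m → <⇒≱ 2^m<2^n (^-monoʳ-≤ 2 n≤m))

y<2^m⇒y<2^n : ∀ {m n y} → m ≤ n → y < 2 ^ m → y < 2 ^ n
y<2^m⇒y<2^n m≤n y<2^m = <-≤-trans y<2^m (^-monoʳ-≤ 2 m≤n)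

y<2^[1+n]⇒y/2<2^n : ∀ n {y} → y < 2 ^ suc n → y / 2 < 2 ^ n
y<2^[1+n]⇒y/2<2^n n {y} y<2^[1+n] = m<n*o⇒m/o<n (subst (y <_) (*-comm 2 (2 ^ n)) y<2^[1+n])

[2^[1+n]+y]/2≡2^n+y/2 : ∀ n y → (2 ^ suc n + y) / 2 ≡ 2 ^ n + y / 2
[2^[1+n]+y]/2≡2^n+y/2 n y = begin
  (2 ^ suc n + y) / 2       ≡⟨ +-distrib-/-∣ˡ y (m∣m*n (2 ^ n)) ⟩
  2 * 2 ^ n / 2 + y / 2     ≡⟨ cong (_+ y / 2) (/-congˡ (*-comm 2 (2 ^ n))) ⟩
  2 ^ n * 2 / 2 + y / 2     ≡⟨ cong (_+ y / 2) (m*n/n≡m (2 ^ n) 2) ⟩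
  2 ^ n + y / 2             ∎
  where open ≡-Reasoning

[2^[1+n]+y]%2≡y%2 : ∀ n y → (2 ^ suc n + y) % 2 ≡ y % 2
[2^[1+n]+y]%2≡y%2 n y = %-remove-+ˡ y (m∣m*n (2 ^ n))

bit-< : ∀ j {y} → y < 2 ^ j → bit y j ≡ false
bit-< zero {zero} _ = refl
bit-< zero {suc _} (s≤s ())
bit-< (suc j) y<2^[1+j] = bit-< j (y<2^[1+n]⇒y/2<2^n j y<2^[1+j])

bit-2^n+-n : ∀ n {y} → y < 2 ^ n → bit (2 ^ n + y) n ≡ true
bit-2^n+-n zero {zero} _ = refl
bit-2^n+-n zero {suc _} (s≤s ())
bit-2^n+-n (suc n) {y} y<2^[1+n] = begin
  bit ((2 ^ suc n + y) / 2) n   ≡⟨ cong (λ t → bit t n) ([2^[1+n]+y]/2≡2^n+y/2 n y) ⟩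
  bit (2 ^ n + y / 2) n         ≡⟨ bit-2^n+-n n (y<2^[1+n]⇒y/2<2^n n y<2^[1+n]) ⟩
  true                          ∎
  where open ≡-Reasoning

bit-2^n+ : ∀ n {y} j → y < 2 ^ n → j ≢ n → bit (2 ^ n + y) j ≡ bit y j
bit-2^n+ zero {zero} zero _ j≢n = contradiction refl j≢n
bit-2^n+ zero {zero} (suc j) _ _ = refl
bit-2^n+ zero {suc _} _ (s≤s ()) _
bit-2^n+ (suc n) {y} zero _ _ = cong (_≡ᵇ 1) ([2^[1+n]+y]%2≡y%2 n y)
bit-2^n+ (suc n) {y} (suc j) y<2^[1+n] 1+j≢1+n = begin
  bit ((2 ^ suc n + y) / 2) j   ≡⟨ cong (λ t → bit t j) ([2^[1+n]+y]/2≡2^n+y/2 n y) ⟩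
  bit (2 ^ n + y / 2) j         ≡⟨ bit-2^n+ n j (y<2^[1+n]⇒y/2<2^n n y<2^[1+n]) (1+j≢1+n ∘ cong suc) ⟩
  bit (y / 2) j                 ∎
  where open ≡-Reasoning

adjacentOnes : ℕ → ℕ → Bool
adjacentOnes x j = bit x j ∧ bit x (suc j)

noAdjOnes≡true⇔ : ∀ x → noAdjOnes x ≡ true ⇔ (∀ j → adjacentOnes x j ≡ false)
noAdjOnes≡true⇔ x = mk⇔ sound complete
  where
    sound : noAdjOnes x ≡ true → ∀ j → adjacentOnes x j ≡ false
    sound noAdj j with j <? x
    ... | yes j<x = to T-not-≡ (applyUpTo⁻ _ x (all⁺ _ (upTo x) (from T-≡ noAdj)) j<x)
    ... | no j≮x = cong (_∧ bit x (suc j)) (bit-< j (≤-<-trans (≮⇒≥ j≮x) (n<2^n j)))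

    complete : (∀ j → adjacentOnes x j ≡ false) → noAdjOnes x ≡ true
    complete none = to T-≡ (all⁻ _ (applyUpTo⁺₂ _ x (λ j → from T-not-≡ (none j))))

noAdjOnes-cong : ∀ a b → (∀ j → adjacentOnes a j ≡ adjacentOnes b j) → noAdjOnes a ≡ noAdjOnes b
noAdjOnes-cong a b a≗b = ⇔→≡ (mk⇔
  (λ noAdj-a → from (noAdjOnes≡true⇔ b) (λ j → trans (sym (a≗b j)) (to (noAdjOnes≡true⇔ a) noAdj-a j)))
  (λ noAdj-b → from (noAdjOnes≡true⇔ a) (λ j → trans (a≗b j) (to (noAdjOnes≡true⇔ b) noAdj-b j))))

adjacentOnes⇒noAdjOnes≡false : ∀ x j → adjacentOnes x j ≡ true → noAdjOnes x ≡ false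
adjacentOnes⇒noAdjOnes≡false x j adj = ¬-not λ noAdj →
  contradiction (trans (sym adj) (to (noAdjOnes≡true⇔ x) noAdj j)) λ ()

adjacentOnes-2^[1+m]+ : ∀ m {y} → y < 2 ^ m → ∀ j → adjacentOnes (2 ^ suc m + y) j ≡ adjacentOnes y j
adjacentOnes-2^[1+m]+ m {y} y<2^m j with <-cmp j m
... | tri< j<m _ _ =
  cong₂ _∧_ (bit-2^n+ (suc m) j y<2^[1+m] (<⇒≢ (m<n⇒m<1+n j<m))) (bit-2^n+ (suc m) (suc j) y<2^[1+m] (<⇒≢ (s≤s j<m)))
  where y<2^[1+m] = y<2^m⇒y<2^n (n≤1+n m) y<2^m
... | tri≈ _ refl _ =
  trans (cong (_∧ bit (2 ^ suc m + y) (suc m)) (trans (bit-2^n+ (suc m) m y<2^[1+m] (<⇒≢ (n<1+n m))) (bit-< m y<2^m)))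
        (sym (cong (_∧ bit y (suc m)) (bit-< m y<2^m)))
  where y<2^[1+m] = y<2^m⇒y<2^n (n≤1+n m) y<2^m
... | tri> _ _ m<j
  rewrite bit-2^n+ (suc m) (suc j) (y<2^m⇒y<2^n (n≤1+n m) y<2^m) (>⇒≢ (s≤s m<j))
        | bit-< (suc j) (y<2^m⇒y<2^n (m≤n⇒m≤1+n (<⇒≤ m<j)) y<2^m)
        | bit-< j (y<2^m⇒y<2^n (<⇒≤ m<j) y<2^m) = ∧-zeroʳ _

oddFibbinary≡bit0∧noAdjOnes : ∀ x → oddFibbinary x ≡ bit x 0 ∧ noAdjOnes x
oddFibbinary≡bit0∧noAdjOnes zero = refl
oddFibbinary≡bit0∧noAdjOnes (suc x) = refl

oddFibbinary-2^[1+m]+ : ∀ m {y} → y < 2 ^ m → oddFibbinary (2 ^ suc m + y) ≡ oddFibbinary y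
oddFibbinary-2^[1+m]+ m {y} y<2^m = begin
  oddFibbinary (2 ^ suc m + y)                        ≡⟨ oddFibbinary≡bit0∧noAdjOnes (2 ^ suc m + y) ⟩
  bit (2 ^ suc m + y) 0 ∧ noAdjOnes (2 ^ suc m + y)   ≡⟨ cong₂ _∧_ (bit-2^n+ (suc m) 0 y<2^[1+m] λ ())
                                                          (noAdjOnes-cong _ y (adjacentOnes-2^[1+m]+ m y<2^m)) ⟩
  bit y 0 ∧ noAdjOnes y                               ≡⟨ oddFibbinary≡bit0∧noAdjOnes y ⟨
  oddFibbinary y                                      ∎
  where
    open ≡-Reasoning
    y<2^[1+m] = y<2^m⇒y<2^n (n≤1+n m) y<2^m

oddFibbinary-2^[1+m]+2^m+ : ∀ m {y} → y < 2 ^ m → oddFibbinary (2 ^ suc m + (2 ^ m + y)) ≡ false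
oddFibbinary-2^[1+m]+2^m+ m {y} y<2^m = begin
  oddFibbinary x                ≡⟨ oddFibbinary≡bit0∧noAdjOnes x ⟩
  bit x 0 ∧ noAdjOnes x         ≡⟨ cong (bit x 0 ∧_) (adjacentOnes⇒noAdjOnes≡false x m adjacent-at-m) ⟩
  bit x 0 ∧ false               ≡⟨ ∧-zeroʳ _ ⟩
  false                         ∎
  where
    open ≡-Reasoning
    x = 2 ^ suc m + (2 ^ m + y)
    2^m+y<2^[1+m] : 2 ^ m + y < 2 ^ suc m
    2^m+y<2^[1+m] = subst (2 ^ m + y <_) (sym (2^[1+n]≡2^n+2^n m)) (+-monoʳ-< (2 ^ m) y<2^m)
    adjacent-at-m : adjacentOnes x m ≡ true
    adjacent-at-m = cong₂ _∧_
      (trans (bit-2^n+ (suc m) m 2^m+y<2^[1+m] (<⇒≢ (n<1+n m))) (bit-2^n+-n m y<2^m))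
      (bit-2^n+-n (suc m) 2^m+y<2^[1+m])

count : (ℕ → Bool) → ℕ → ℕ
count p zero = 0
count p (suc n) = count p n + (if p n then 1 else 0)

length-filter-upTo : ∀ (p : ℕ → Bool) n → length (filter (T? ∘ p) (upTo n)) ≡ count p n
length-filter-upTo p zero = refl
length-filter-upTo p (suc n) = begin
  length (filter (T? ∘ p) (upTo (suc n)))                       ≡⟨ cong (length ∘ filter (T? ∘ p)) (upTo-∷ʳ n) ⟨
  length (filter (T? ∘ p) (upTo n ++ [ n ]))                    ≡⟨ cong length (filter-++ (T? ∘ p) (upTo n) [ n ]) ⟩
  length (filter (T? ∘ p) (upTo n) ++ filter (T? ∘ p) [ n ])    ≡⟨ length-++ (filter (T? ∘ p) (upTo n)) ⟩
  length (filter (T? ∘ p) (upTo n)) + length (filter (T? ∘ p) [ n ])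
                                                                ≡⟨ cong₂ _+_ (length-filter-upTo p n) length-filter-[n] ⟩
  count p n + (if p n then 1 else 0)                            ∎
  where
    open ≡-Reasoning
    length-filter-[n] : length (filter (T? ∘ p) [ n ]) ≡ (if p n then 1 else 0)
    length-filter-[n] with p n
    ... | true = refl
    ... | false = refl

count-+ : ∀ p m n → count p (m + n) ≡ count p m + count (λ i → p (m + i)) n
count-+ p m zero = trans (cong (count p) (+-identityʳ m)) (sym (+-identityʳ _))
count-+ p m (suc n) rewrite +-suc m n =
  trans (cong (_+ (if p (m + n) then 1 else 0)) (count-+ p m n)) (+-assoc (count p m) _ _)

count-cong : ∀ {p q} n → (∀ {i} → i < n → p i ≡ q i) → count p n ≡ count q n
count-cong zero _ = refl
count-cong (suc n) p≗q =
  cong₂ (λ c b → c + (if b then 1 else 0)) (count-cong n (p≗q ∘ m<n⇒m<1+n)) (p≗q (n<1+n n))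

count-none : ∀ {p} n → (∀ {i} → i < n → p i ≡ false) → count p n ≡ 0
count-none zero _ = refl
count-none (suc n) none =
  cong₂ (λ c b → c + (if b then 1 else 0)) (count-none n (none ∘ m<n⇒m<1+n)) (none (n<1+n n))

count-mono : ∀ p {m n} → m ≤ n → count p m ≤ count p n
count-mono p {m} m≤n = subst (λ n → count p m ≤ count p n) (m+[n∸m]≡n m≤n)
  (subst (count p m ≤_) (sym (count-+ p m _)) (m≤m+n _ _))

count-cancel-< : ∀ p {m n} → count p m < count p n → m < n
count-cancel-< p lt = ≰⇒> (λ n≤m → <⇒≱ lt (count-mono p n≤m))

count-oddFibbinary-2^ : ∀ m → count oddFibbinary (2 ^ m) ≡ F m
count-oddFibbinary-2^ zero = refl
count-oddFibbinary-2^ (suc zero) = refl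
count-oddFibbinary-2^ (suc (suc m)) = begin
  count oddFibbinary (2 ^ suc (suc m))                          ≡⟨ cong (count oddFibbinary) 2^[2+m]-split ⟩
  count oddFibbinary (2 ^ suc m + (2 ^ m + 2 ^ m))              ≡⟨ count-+ oddFibbinary (2 ^ suc m) _ ⟩
  count oddFibbinary (2 ^ suc m) + count upper (2 ^ m + 2 ^ m)  ≡⟨ cong₂ _+_ (count-oddFibbinary-2^ (suc m)) (count-+ upper (2 ^ m) _) ⟩
  F (suc m) + (count upper (2 ^ m) + count (λ i → upper (2 ^ m + i)) (2 ^ m))
    ≡⟨ cong (F (suc m) +_) (cong₂ _+_
         (trans (count-cong (2 ^ m) (oddFibbinary-2^[1+m]+ m)) (count-oddFibbinary-2^ m))
         (count-none (2 ^ m) (oddFibbinary-2^[1+m]+2^m+ m))) ⟩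
  F (suc m) + (F m + 0)                                         ≡⟨ cong (F (suc m) +_) (+-identityʳ (F m)) ⟩
  F (suc (suc m))                                               ∎
  where
    open ≡-Reasoning
    upper : ℕ → Bool
    upper i = oddFibbinary (2 ^ suc m + i)
    2^[2+m]-split : 2 ^ suc (suc m) ≡ 2 ^ suc m + (2 ^ m + 2 ^ m)
    2^[2+m]-split = trans (2^[1+n]≡2^n+2^n (suc m)) (cong (2 ^ suc m +_) (2^[1+n]≡2^n+2^n m))

count-oddFibbinary-2^[1+m]+ : ∀ m {x} → x ≤ 2 ^ m →
                              count oddFibbinary (2 ^ suc m + x) ≡ F (suc m) + count oddFibbinary x
count-oddFibbinary-2^[1+m]+ m {x} x≤2^m =
  trans (count-+ oddFibbinary (2 ^ suc m) _)
        (cong₂ _+_ (count-oddFibbinary-2^ (suc m))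
                   (count-cong x (λ i<x → oddFibbinary-2^[1+m]+ m (<-≤-trans i<x x≤2^m))))

IsOdfib-<2^ : ∀ m {k x} → IsOdfib k x → k ≤ F m → x < 2 ^ m
IsOdfib-<2^ m {k} {x} (_ , _ , count-x) k≤Fm = count-cancel-< oddFibbinary (begin-strict
  count oddFibbinary x                   ≡⟨ length-filter-upTo oddFibbinary x ⟨
  countOddFibbinaryBelow x               <⟨ n<1+n _ ⟩
  suc (countOddFibbinaryBelow x)         ≡⟨ count-x ⟩
  k                                      ≤⟨ k≤Fm ⟩
  F m                                    ≡⟨ count-oddFibbinary-2^ m ⟨
  count oddFibbinary (2 ^ m)             ∎)
  where open ≤-Reasoning

IsOdfib-2^[1+m]+ : ∀ m {k x} → IsOdfib k x → x < 2 ^ m → IsOdfib (F (suc m) + k) (2 ^ suc m + x)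
IsOdfib-2^[1+m]+ m {k} {x} (1≤k , odd-x , count-x) x<2^m =
  ≤-trans 1≤k (m≤n+m k _) , subst T (sym (oddFibbinary-2^[1+m]+ m x<2^m)) odd-x , count-shifted
  where
    open ≡-Reasoning
    count-shifted : suc (countOddFibbinaryBelow (2 ^ suc m + x)) ≡ F (suc m) + k
    count-shifted = begin
      suc (countOddFibbinaryBelow (2 ^ suc m + x))  ≡⟨ cong suc (length-filter-upTo oddFibbinary (2 ^ suc m + x)) ⟩
      suc (count oddFibbinary (2 ^ suc m + x))      ≡⟨ cong suc (count-oddFibbinary-2^[1+m]+ m (<⇒≤ x<2^m)) ⟩
      suc (F (suc m) + count oddFibbinary x)        ≡⟨ +-suc (F (suc m)) _ ⟨
      F (suc m) + suc (count oddFibbinary x)        ≡⟨ cong (F (suc m) +_) (trans (cong suc (sym (length-filter-upTo oddFibbinary x))) count-x) ⟩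
      F (suc m) + k                                 ∎

IsZeck-∷ : ∀ {m l} → IsZeck l → bval l < 2 ^ m → IsZeck (3 + m ∷ l)
IsZeck-∷ zeck-[] _ = zeck-1 (s≤s (s≤s z≤n))
IsZeck-∷ {m} {j ∷ l} zeck-l bval<2^m = zeck-∷ (subst (_≤ 3 + m) (+-comm 2 j) (s≤s (s≤s j≤1+m))) zeck-l
  where
    j∸2<m : j ∸ 2 < m
    j∸2<m = 2^-cancel-< (j ∸ 2) m (≤-<-trans (m≤m+n _ _) bval<2^m)
    j≤1+m : j ≤ suc m
    j≤1+m = ≤-trans (m≤n+m∸n j 2) (s≤s j∸2<m)

IsFib-2^[1+m]+ : ∀ m {z x} → IsFib z x → x < 2 ^ m → IsFib (F (3 + m) + z) (2 ^ suc m + x)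
IsFib-2^[1+m]+ m {z} (1≤z , l , zeck-l , zval-l , bval-l) x<2^m =
  ≤-trans 1≤z (m≤n+m z _) , 3 + m ∷ l ,
  IsZeck-∷ zeck-l (subst (_< 2 ^ m) (sym bval-l) x<2^m) ,
  cong (F (3 + m) +_) zval-l , cong (2 ^ suc m +_) bval-l

lemma2 : ∀ (n k : ℕ) → 2 ≤ n → 1 ≤ k → k ≤ F (n ∸ 1) →
    ∀ (z : ℕ) → IsZ k z → IsZ (F n + k) (F (suc (suc n)) + z)
lemma2 .(suc (suc p)) k (s≤s (s≤s {n = p} z≤n)) _ k≤F z (x , odfib-k , fib-z) =
  2 ^ suc (suc p) + x , IsOdfib-2^[1+m]+ (suc p) odfib-k x<2^[1+p] , IsFib-2^[1+m]+ (suc p) fib-z x<2^[1+p]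
  where
    x<2^[1+p] : x < 2 ^ suc p
    x<2^[1+p] = IsOdfib-<2^ (suc p) odfib-k k≤F
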